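{- For every natural number $n \geq 0$, the empty clause $\vdash$ is derivable by resolution from the clause set $C(n)$.
   Context: Work in a first-order language with a constant $0$, unary function symbols $s$ and $f$, a binary function symbol $\max$, a binary predicate symbol $\leq$, and atoms of the form $f(t)=k$ where $t$ is a term and $k$ is a numeral; here $=$ is an uninterpreted binary predicate (no equality axioms are assumed). A clause is a sequent $\Pi \vdash \Delta$ of finite multisets of atoms; its variables are implicitly universally quantified. For $n\ge 0$, the clause set $C(n)$ consists of the following clauses, where $\alpha,\beta,\gamma$ are variables: (C1) $\vdash \alpha \leq \alpha$; (C2) $\max(\alpha,\beta)\leq\gamma \vdash \alpha\leq\gamma$; (C3) $\max(\alpha,\beta)\leq\gamma \vdash \beta\leq\gamma$; (C4$(k)$) $f(\beta)=k,\ f(\alpha)=k,\ s(\beta)\leq\alpha \vdash$, one for each $k$ with $0\le k\le n$; (C5) $\vdash f(\alpha)=0, f(\alpha)=1,\ldots, f(\alpha)=n$. A clause is derivable by resolution from $C(n)$ if it is obtained in finitely many steps from variable-renamed copies of clauses of $C(n)$ using: the resolution rule (from $\Pi\vdash P,\Delta$ and $\Pi',P'\vdash\Delta'$ and a substitution $\sigma$ with $P\sigma=P'\sigma$, infer $\Pi\sigma,\Pi'\sigma\vdash\Delta\sigma,\Delta'\sigma$) and contraction (merging identical atoms on the same side of a clause). -}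

module Defs where

open import Data.Nat using (ℕ; zero; suc; _≤_)
open import Data.List using (List; []; _∷_; _++_; map; upTo)
open import Data.List.Relation.Binary.Permutation.Propositional using (_↭_)
open import Relation.Binary.PropositionalEquality using (_≡_)
open import Function.Definitions using (Injective)

data Term : Set where
  var  : ℕ → Term
  `0   : Term
  s    : Term → Term
  f    : Term → Term
  max  : Term → Term → Term

num : ℕ → Term
num zero    = `0
num (suc k) = s (num k)

-- Atoms: t ≤ u, and t = u with = an uninterpreted binary predicate
-- (the atoms f(t)=k are eqA (f t) (num k)).
data Atom : Set where
  leqA : Term → Term → Atom
  eqA  : Term → Term → Atom

-- A clause Π ⊢ Δ; multisets are represented by lists modulo permutation
-- (see the rule `perm` of Derivable).
record Clause : Set where
  constructor _⊢_
  field
    ante : List Atom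
    succ : List Atom
open Clause public

infix 4 _⊢_

Subst : Set
Subst = ℕ → Term

substT : Subst → Term → Term
substT σ (var x)   = σ x
substT σ `0        = `0
substT σ (s t)     = s (substT σ t)
substT σ (f t)     = f (substT σ t)
substT σ (max t u) = max (substT σ t) (substT σ u)

substA : Subst → Atom → Atom
substA σ (leqA t u) = leqA (substT σ t) (substT σ u)
substA σ (eqA t u)  = eqA (substT σ t) (substT σ u)

substL : Subst → List Atom → List Atom
substL σ = map (substA σ)

substC : Subst → Clause → Clause
substC σ (Π ⊢ Δ) = substL σ Π ⊢ substL σ Δ

rename : (ℕ → ℕ) → Subst
rename ρ x = var (ρ x)

α β γ : Term
α = var 0
β = var 1
γ = var 2

fEq : Term → ℕ → Atom
fEq t k = eqA (f t) (num k)

data C (n : ℕ) : Clause → Set where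
  C1 : C n ([] ⊢ leqA α α ∷ [])
  C2 : C n (leqA (max α β) γ ∷ [] ⊢ leqA α γ ∷ [])
  C3 : C n (leqA (max α β) γ ∷ [] ⊢ leqA β γ ∷ [])
  C4 : (k : ℕ) → k ≤ n →
       C n (fEq β k ∷ fEq α k ∷ leqA (s β) α ∷ [] ⊢ [])
  C5 : C n ([] ⊢ map (fEq α) (upTo (suc n)))

data Derivable (n : ℕ) : Clause → Set where
  init  : ∀ {c} (ρ : ℕ → ℕ) → Injective _≡_ _≡_ ρ → C n c →
          Derivable n (substC (rename ρ) c)
  perm  : ∀ {Π Π′ Δ Δ′} → Π ↭ Π′ → Δ ↭ Δ′ →
          Derivable n (Π ⊢ Δ) → Derivable n (Π′ ⊢ Δ′)
  resolve : ∀ {Π Δ Π′ Δ′ P P′} (σ : Subst) → substA σ P ≡ substA σ P′ →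
          Derivable n (Π ⊢ P ∷ Δ) → Derivable n (P′ ∷ Π′ ⊢ Δ′) →
          Derivable n (substL σ Π ++ substL σ Π′ ⊢ substL σ Δ ++ substL σ Δ′)
  contrL : ∀ {Π Δ P} → Derivable n (P ∷ P ∷ Π ⊢ Δ) → Derivable n (P ∷ Π ⊢ Δ)
  contrR : ∀ {Π Δ P} → Derivable n (Π ⊢ P ∷ P ∷ Δ) → Derivable n (Π ⊢ P ∷ Δ)

-- The n + 2 ground terms p 0, p 1, …, p (n + 1), where p (k + 1) = max (s (p k)) (p k), are
-- pairwise ordered, ⊢ s (p i) ≤ p j for i < j, using only C1–C3. Resolving this against C4
-- shows that no two of them can share a value, while C5 gives each one of n + 1 values; the
-- resolution refutation of the pigeonhole principle then derives the empty clause.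
module Submission where

open import Defs
open import Data.Nat using (ℕ; zero; suc; _+_; _≤_; _<_; z≤n; s≤s; s≤s⁻¹; _≤′_; ≤′-refl; ≤′-step)
open import Data.Nat.Properties using (+-cancelˡ-≡; suc-injective; <⇒<′)
open import Data.List using (List; []; _∷_; _++_; [_]; map; upTo; length)
open import Data.List.Properties using (map-cong; map-id; map-∘; ++-identityʳ; length-upTo)
open import Data.List.Relation.Unary.All as All using (All; []; _∷_)
open import Data.List.Relation.Unary.All.Properties using (all-upTo)
open import Data.List.Relation.Binary.Permutation.Propositional
  using (_↭_; prep; swap; ↭-refl; ↭-sym; ↭-trans; ↭-reflexive)
open import Data.List.Relation.Binary.Permutation.Propositional.Properties
  using (map⁺; ++⁺ˡ; ++-comm; shift; shifts; ↭-length; ↭-reverse; All-resp-↭)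
open import Function using (id; _∘_)
open import Relation.Binary.PropositionalEquality using (_≡_; refl; sym; trans; cong; cong₂; subst)

substT-var : ∀ t → substT var t ≡ t
substT-var (var x)   = refl
substT-var `0        = refl
substT-var (s t)     = cong s (substT-var t)
substT-var (f t)     = cong f (substT-var t)
substT-var (max t u) = cong₂ max (substT-var t) (substT-var u)

substA-var : ∀ a → substA var a ≡ a
substA-var (leqA t u) = cong₂ leqA (substT-var t) (substT-var u)
substA-var (eqA t u)  = cong₂ eqA (substT-var t) (substT-var u)

substL-var : ∀ Π → substL var Π ≡ Π
substL-var Π = trans (map-cong substA-var Π) (map-id Π)

substC-var : ∀ c → substC var c ≡ c
substC-var (Π ⊢ Δ) = cong₂ _⊢_ (substL-var Π) (substL-var Δ)

data Ground : Term → Set where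
  `0   : Ground `0
  s    : ∀ {t} → Ground t → Ground (s t)
  f    : ∀ {t} → Ground t → Ground (f t)
  max  : ∀ {t u} → Ground t → Ground u → Ground (max t u)

substT-ground : ∀ {t} → Ground t → ∀ σ → substT σ t ≡ t
substT-ground `0        σ = refl
substT-ground (s g)     σ = cong s (substT-ground g σ)
substT-ground (f g)     σ = cong f (substT-ground g σ)
substT-ground (max g h) σ = cong₂ max (substT-ground g σ) (substT-ground h σ)

ground-num : ∀ k → Ground (num k)
ground-num zero    = `0
ground-num (suc k) = s (ground-num k)

substA-fEq : ∀ σ t k → substA σ (fEq t k) ≡ fEq (substT σ t) k
substA-fEq σ t k = cong (eqA (f (substT σ t))) (substT-ground (ground-num k) σ)

substL-map-fEq : ∀ σ t A → substL σ (map (fEq t) A) ≡ map (fEq (substT σ t)) A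
substL-map-fEq σ t A = trans (sym (map-∘ A)) (map-cong (substA-fEq σ t) A)

assign : List Term → Subst
assign []       x       = var x
assign (t ∷ ts) zero    = t
assign (t ∷ ts) (suc x) = assign ts x

tabulate-↭ : ∀ {A : Set} {P : A → Set} {xs : List A} →
             (∀ {x ys} → xs ↭ x ∷ ys → P x) → All P xs
tabulate-↭ {xs = []}     h = []
tabulate-↭ {xs = x ∷ xs} h = h ↭-refl ∷ tabulate-↭ (λ π → h (↭-trans (prep x π) (swap x _ ↭-refl)))

length-↭-∷ : ∀ {A : Set} {xs ys : List A} {x m} → xs ↭ x ∷ ys → length xs ≡ suc m → length ys ≡ m
length-↭-∷ π len = suc-injective (trans (sym (↭-length π)) len)

module _ {n : ℕ} where

  axiom : ∀ {c} → C n c → Derivable n c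
  axiom {c} γ = subst (Derivable n) (substC-var c) (init id id γ)

  cut : ∀ {Π P Δ Π′ Δ′} → Derivable n (Π ⊢ P ∷ Δ) → Derivable n (P ∷ Π′ ⊢ Δ′) →
        Derivable n (Π ++ Π′ ⊢ Δ ++ Δ′)
  cut {Π} {Δ = Δ} {Π′} {Δ′} D E =
    subst (Derivable n)
      (cong₂ _⊢_ (cong₂ _++_ (substL-var Π) (substL-var Π′)) (cong₂ _++_ (substL-var Δ) (substL-var Δ′)))
      (resolve var refl D E)

  contract-++ : ∀ Γ {Π Δ} → Derivable n (Γ ++ Γ ++ Π ⊢ Δ) → Derivable n (Γ ++ Π ⊢ Δ)
  contract-++ []      D = D
  contract-++ (g ∷ Γ) {Π} D =
    perm (shift g Γ Π) ↭-refl
      (contract-++ Γ (perm (↭-trans (shifts [ g ] Γ) (++⁺ˡ Γ (shifts [ g ] Γ))) ↭-refl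
        (contrL (perm (prep g (shift g Γ (Γ ++ Π))) ↭-refl D))))

  cut-shared : ∀ {Γ P Δ} → Derivable n (Γ ⊢ P ∷ Δ) → Derivable n (P ∷ Γ ⊢ []) → Derivable n (Γ ⊢ Δ)
  cut-shared {Γ} {P} {Δ} D E =
    subst (Derivable n) (cong₂ _⊢_ (++-identityʳ Γ) (++-identityʳ Δ))
      (contract-++ Γ (cut D (subst (λ Π → Derivable n (P ∷ Π ⊢ [])) (sym (++-identityʳ Γ)) E)))

  cut-exclusion : ∀ {Γ P Q Δ} → Derivable n (Γ ⊢ P ∷ Δ) → Derivable n (P ∷ Q ∷ [] ⊢ []) →
                  Derivable n (Q ∷ Γ ⊢ Δ)
  cut-exclusion {Γ} {Q = Q} {Δ} D E = perm (++-comm Γ [ Q ]) (↭-reflexive (++-identityʳ Δ)) (cut D E)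

  cases : ∀ {Γ t A} → Derivable n (Γ ⊢ map (fEq t) A) →
          All (λ k → Derivable n (fEq t k ∷ Γ ⊢ [])) A → Derivable n (Γ ⊢ [])
  cases D []       = D
  cases D (E ∷ Es) = cases (cut-shared D E) Es

  -- C1 renamed apart from the variables α, β, γ of C2 and C3, so that one substitution unifies them.
  C1-apart : Derivable n ([] ⊢ leqA (var 3) (var 3) ∷ [])
  C1-apart = init (3 +_) (λ {x} {y} → +-cancelˡ-≡ 3 x y) C1

  max-leˡ : ∀ a b → Derivable n ([] ⊢ leqA a (max a b) ∷ [])
  max-leˡ a b = resolve (assign (a ∷ b ∷ max a b ∷ max a b ∷ [])) refl C1-apart (axiom C2)

  max-leʳ : ∀ a b → Derivable n ([] ⊢ leqA b (max a b) ∷ [])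
  max-leʳ a b = resolve (assign (a ∷ b ∷ max a b ∷ max a b ∷ [])) refl C1-apart (axiom C3)

  max-le⇒leˡ : ∀ {a b c} → Ground a → Ground b → Ground c →
               Derivable n ([] ⊢ leqA (max a b) c ∷ []) → Derivable n ([] ⊢ leqA a c ∷ [])
  max-le⇒leˡ {a} {b} {c} ga gb gc D =
    resolve σ (cong₂ leqA (substT-ground (max ga gb) σ) (substT-ground gc σ)) D (axiom C2)
    where
    σ : Subst
    σ = assign (a ∷ b ∷ c ∷ [])

  max-le⇒leʳ : ∀ {a b c} → Ground a → Ground b → Ground c →
               Derivable n ([] ⊢ leqA (max a b) c ∷ []) → Derivable n ([] ⊢ leqA b c ∷ [])
  max-le⇒leʳ {a} {b} {c} ga gb gc D =
    resolve σ (cong₂ leqA (substT-ground (max ga gb) σ) (substT-ground gc σ)) D (axiom C3)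
    where
    σ : Subst
    σ = assign (a ∷ b ∷ c ∷ [])

p : ℕ → Term
p zero    = `0
p (suc k) = max (s (p k)) (p k)

ground-p : ∀ k → Ground (p k)
ground-p zero    = `0
ground-p (suc k) = max (s (ground-p k)) (ground-p k)

module _ {n : ℕ} where

  p-le-downward : ∀ {k j c} → Ground c → k ≤′ j →
                  Derivable n ([] ⊢ leqA (p j) c ∷ []) → Derivable n ([] ⊢ leqA (p k) c ∷ [])
  p-le-downward gc ≤′-refl           D = D
  p-le-downward gc (≤′-step {j} k≤j) D =
    p-le-downward gc k≤j (max-le⇒leʳ (s (ground-p j)) (ground-p j) gc D)

  s-p<p : ∀ {k j} → k < j → Derivable n ([] ⊢ leqA (s (p k)) (p j) ∷ [])
  s-p<p {k} k<j with <⇒<′ k<j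
  ... | ≤′-refl           = max-leˡ (s (p k)) (p k)
  ... | ≤′-step {j} sk≤j  =
    max-le⇒leˡ (s (ground-p k)) (ground-p k) (ground-p (suc j))
      (p-le-downward (ground-p (suc j)) sk≤j (max-leʳ (s (p j)) (p j)))

Separated : ℕ → (ℕ → Term) → Set
Separated n q = ∀ {k i j} → k ≤ n → i < j → Derivable n (fEq (q j) k ∷ fEq (q i) k ∷ [] ⊢ [])

p-separated : ∀ {n} → Separated n p
p-separated {n} {k} {i} {j} k≤n i<j =
  subst (Derivable n) (cong (_⊢ []) (cong₂ _∷_ (substA-fEq σ α k) (cong [_] (substA-fEq σ β k))))
    (resolve σ (cong₂ leqA (substT-ground (s (ground-p i)) σ) (substT-ground (ground-p j) σ)) (s-p<p i<j) C4′)
  where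
  σ : Subst
  σ = assign (p j ∷ p i ∷ [])
  C4′ : Derivable n (leqA (s β) α ∷ fEq α k ∷ fEq β k ∷ [] ⊢ [])
  C4′ = perm (↭-sym (↭-reverse _)) ↭-refl (axiom (C4 k k≤n))

separated-suc : ∀ {n q} → Separated n q → Separated n (q ∘ suc)
separated-suc sep k≤n i<j = sep k≤n (s≤s i<j)

-- C5 has no ground instances of its own: it can only be instantiated while resolving away one value.
C5-instance : ∀ {n u k A Π} → Ground u → upTo (suc n) ↭ k ∷ A → (∀ σ → substL σ Π ≡ Π) →
              Derivable n (fEq u k ∷ Π ⊢ []) → Derivable n (Π ⊢ map (fEq u) A)
C5-instance {n} {u} {k} {A} gu π closed E =
  subst (Derivable n) (cong₂ _⊢_ (closed σ) (trans (++-identityʳ _) (substL-map-fEq σ α A)))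
    (resolve σ (cong (λ t → eqA (f t) (substT σ (num k))) (sym (substT-ground gu σ))) C5′ E)
  where
  σ : Subst
  σ _ = u
  C5′ : Derivable n ([] ⊢ fEq α k ∷ map (fEq α) A)
  C5′ = perm ↭-refl (map⁺ (fEq α) π) (axiom C5)

pigeonhole : ∀ {n} m {q Γ A} → Separated n q → length A ≡ m → All (_≤ n) A →
             (∀ i → i ≤ m → Derivable n (Γ ⊢ map (fEq (q i)) A)) → Derivable n (Γ ⊢ [])
pigeonhole zero    {A = []} sep len bounds covers = covers 0 z≤n
pigeonhole {n} (suc m) {q} {Γ} {A} sep len bounds covers = cases (covers 0 z≤n) (tabulate-↭ excluded)
  where
  excluded : ∀ {k A′} → A ↭ k ∷ A′ → Derivable n (fEq (q 0) k ∷ Γ ⊢ [])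
  excluded {k} {A′} π = pigeonhole m (separated-suc sep) (length-↭-∷ π len) (All.tail bounds′) covers′
    where
    bounds′ : All (_≤ n) (k ∷ A′)
    bounds′ = All-resp-↭ π bounds
    covers′ : ∀ i → i ≤ m → Derivable n (fEq (q 0) k ∷ Γ ⊢ map (fEq (q (suc i))) A′)
    covers′ i i≤m = cut-exclusion (perm ↭-refl (map⁺ (fEq (q (suc i))) π) (covers (suc i) (s≤s i≤m)))
                                  (sep (All.head bounds′) (s≤s z≤n))

p0-value-refuted : ∀ {n k A} → upTo (suc n) ↭ k ∷ A → Derivable n (fEq (p 0) k ∷ [] ⊢ [])
p0-value-refuted {n} {k} {A} π =
  pigeonhole n (separated-suc p-separated) (length-↭-∷ π (length-upTo (suc n))) (All.tail bounds) covers
  where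
  bounds : All (_≤ n) (k ∷ A)
  bounds = All.map s≤s⁻¹ (All-resp-↭ π (all-upTo (suc n)))
  covers : ∀ i → i ≤ n → Derivable n (fEq (p 0) k ∷ [] ⊢ map (fEq (p (suc i))) A)
  covers i _ = C5-instance (ground-p (suc i)) π (λ σ → cong [_] (substA-fEq σ (p 0) k))
                 (p-separated (All.head bounds) (s≤s z≤n))

-- upTo (suc n) reduces to 0 ∷ …, so E₀ refutes f(p 0) = 0 and C5-instance turns it into the
-- statement that p 0 takes one of the remaining values.
theorem2 : (n : ℕ) → Derivable n ([] ⊢ [])
theorem2 n with tabulate-↭ (p0-value-refuted {n})
... | E₀ ∷ Es = cases (C5-instance `0 ↭-refl (λ _ → refl) E₀) Es
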